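{- Let $Q$ be a quasivariety of commutative integral residuated lattices and let $Q^*$ be the quasivariety generated by $\{\mathbf A^*:\mathbf A\in Q\}$. For every quasi-equation $q=q(\vec x):=\ \&\{e_i:i\in I\}\Longrightarrow e$ in the language $\langle\land,\lor,*,\Rightarrow,1\rangle$ of $Q$ (with $\vec x$ its variables), $Q\models q$ if and only if $Q^*\models q^*$, where $q^*:=\ \&(\{e_i:i\in I\}\cup\{\neg x\sqsubseteq x:x\in\vec x\})\Longrightarrow e$ and $\neg x\sqsubseteq x$ abbreviates $x\lor\neg x\approx x$.
   Context: A commutative integral residuated lattice (CIRL) is an algebra $\langle A,\land,\lor,*,\Rightarrow,1\rangle$ such that $\langle A,\land,\lor\rangle$ is a lattice with top element $1$, $\langle A,*,1\rangle$ is a commutative monoid, and $a*b\le c$ iff $b\le a\Rightarrow c$. Quasi-equations have finitely many premisses. Doubling: given a CIRL $\mathbf A$, let $\neg A=\{\neg a:a\in A\}$ be a disjoint copy of $A$ and $A^*=A\cup\neg A$. Order $A^*$ by: for $a,b\in A$, $a\le b$ iff $a\le_A b$; $\neg a\le b$ always; $\neg a\le\neg b$ iff $b\le_A a$ (and $a\not\le\neg b$). Set $\neg(\neg a):=a$; on $A$ the operations are those of $\mathbf A$; $\neg a\land\neg b:=\neg(a\lor b)$, $\neg a\lor\neg b:=\neg(a\land b)$ (mixed meets/joins are determined by the order); $a*\neg b=\neg b*a:=\neg(a\Rightarrow b)$, $\neg a*\neg b:=\neg1$; $a\Rightarrow\neg b:=\neg(a*b)$, $\neg a\Rightarrow\neg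 b:=b\Rightarrow a$, $\neg a\Rightarrow b:=1$; the constants are $1$ and $0:=\neg 1$. Then $\mathbf A^*=\langle A^*,\land,\lor,*,\Rightarrow,\neg,0,1\rangle$. -}

module Defs where

open import Level using (Level; _⊔_; suc)
open import Data.Nat using (ℕ)
open import Data.Sum using (_⊎_; inj₁; inj₂)
open import Data.Product using (_×_; _,_; Σ)
open import Data.List using (List; []; _∷_; _++_; map; concatMap)
open import Data.List.Relation.Unary.All using (All)
open import Relation.Binary.PropositionalEquality using (_≡_)
open import Function.Bundles using (_⇔_)

record CIRL (a : Level) : Set (suc a) where
  infixr 7 _∧_
  infixr 6 _∨_
  infixr 8 _*_
  infixr 5 _⇒_
  field
    Carrier : Set a
    _∧_ _∨_ _*_ _⇒_ : Carrier → Carrier → Carrier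
    one : Carrier
    ∧-comm : ∀ x y → x ∧ y ≡ y ∧ x
    ∨-comm : ∀ x y → x ∨ y ≡ y ∨ x
    ∧-assoc : ∀ x y z → (x ∧ y) ∧ z ≡ x ∧ (y ∧ z)
    ∨-assoc : ∀ x y z → (x ∨ y) ∨ z ≡ x ∨ (y ∨ z)
    ∧-absorbs-∨ : ∀ x y → x ∧ (x ∨ y) ≡ x
    ∨-absorbs-∧ : ∀ x y → x ∨ (x ∧ y) ≡ x
    one-top : ∀ x → x ∧ one ≡ x
    *-comm : ∀ x y → x * y ≡ y * x
    *-assoc : ∀ x y z → (x * y) * z ≡ x * (y * z)
    *-identityˡ : ∀ x → one * x ≡ x

  _≤_ : Carrier → Carrier → Set a
  x ≤ y = x ∧ y ≡ x

  field
    residuation : ∀ x y z → ((x * y) ≤ z) ⇔ (y ≤ (x ⇒ z))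

record Struct* (a : Level) : Set (suc a) where
  field
    Carrier : Set a
    _∧_ _∨_ _*_ _⇒_ : Carrier → Carrier → Carrier
    ¬_ : Carrier → Carrier
    zero one : Carrier

-- Doubling  A ↦ A*.  Carrier A ⊎ A, inj₁ a = a, inj₂ a = ¬a.

module _ {a : Level} (A : CIRL a) where
  private
    module A = CIRL A
    D = A.Carrier ⊎ A.Carrier

  dmeet : D → D → D
  dmeet (inj₁ x) (inj₁ y) = inj₁ (x A.∧ y)
  dmeet (inj₂ x) (inj₂ y) = inj₂ (x A.∨ y)
  dmeet (inj₂ x) (inj₁ y) = inj₂ x
  dmeet (inj₁ x) (inj₂ y) = inj₂ y

  djoin : D → D → D
  djoin (inj₁ x) (inj₁ y) = inj₁ (x A.∨ y)
  djoin (inj₂ x) (inj₂ y) = inj₂ (x A.∧ y)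
  djoin (inj₂ x) (inj₁ y) = inj₁ y
  djoin (inj₁ x) (inj₂ y) = inj₁ x

  dmul : D → D → D
  dmul (inj₁ x) (inj₁ y) = inj₁ (x A.* y)
  dmul (inj₁ x) (inj₂ y) = inj₂ (x A.⇒ y)
  dmul (inj₂ x) (inj₁ y) = inj₂ (y A.⇒ x)
  dmul (inj₂ x) (inj₂ y) = inj₂ A.one

  dimp : D → D → D
  dimp (inj₁ x) (inj₁ y) = inj₁ (x A.⇒ y)
  dimp (inj₁ x) (inj₂ y) = inj₂ (x A.* y)
  dimp (inj₂ x) (inj₂ y) = inj₁ (y A.⇒ x)
  dimp (inj₂ x) (inj₁ y) = inj₁ A.one

  dneg : D → D
  dneg (inj₁ x) = inj₂ x
  dneg (inj₂ x) = inj₁ x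

  double : Struct* a
  double = record
    { Carrier = D
    ; _∧_ = dmeet ; _∨_ = djoin ; _*_ = dmul ; _⇒_ = dimp
    ; ¬_ = dneg
    ; zero = inj₂ A.one
    ; one = inj₁ A.one
    }

data Term : Set where
  var : ℕ → Term
  _∧ₜ_ _∨ₜ_ _*ₜ_ _⇒ₜ_ : Term → Term → Term
  oneₜ : Term

data Term* : Set where
  var : ℕ → Term*
  _∧ₜ_ _∨ₜ_ _*ₜ_ _⇒ₜ_ : Term* → Term* → Term*
  ¬ₜ_ : Term* → Term*
  zeroₜ oneₜ : Term*

Eqn : Set → Set
Eqn T = T × T

record QEqn (T : Set) : Set where
  constructor _⟹_
  field
    premisses : List (Eqn T)
    conclusion : Eqn T

vars : Term → List ℕ
vars (var x) = x ∷ []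
vars (s ∧ₜ t) = vars s ++ vars t
vars (s ∨ₜ t) = vars s ++ vars t
vars (s *ₜ t) = vars s ++ vars t
vars (s ⇒ₜ t) = vars s ++ vars t
vars oneₜ = []

eqnVars : Eqn Term → List ℕ
eqnVars (s , t) = vars s ++ vars t

qVars : QEqn Term → List ℕ
qVars (ps ⟹ c) = concatMap eqnVars ps ++ eqnVars c

embed : Term → Term*
embed (var x) = var x
embed (s ∧ₜ t) = embed s ∧ₜ embed t
embed (s ∨ₜ t) = embed s ∨ₜ embed t
embed (s *ₜ t) = embed s *ₜ embed t
embed (s ⇒ₜ t) = embed s ⇒ₜ embed t
embed oneₜ = oneₜ

embedEqn : Eqn Term → Eqn Term*
embedEqn (s , t) = embed s , embed t

negBelow : ℕ → Eqn Term*
negBelow x = (var x ∨ₜ (¬ₜ var x)) , var x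

_* : QEqn Term → QEqn Term*
q * = (map embedEqn (QEqn.premisses q) ++ map negBelow (qVars q))
        ⟹ embedEqn (QEqn.conclusion q)

module _ {a : Level} (A : CIRL a) where
  open CIRL A
  ⟦_⟧ : Term → (ℕ → Carrier) → Carrier
  ⟦ var x ⟧ v = v x
  ⟦ s ∧ₜ t ⟧ v = ⟦ s ⟧ v ∧ ⟦ t ⟧ v
  ⟦ s ∨ₜ t ⟧ v = ⟦ s ⟧ v ∨ ⟦ t ⟧ v
  ⟦ s *ₜ t ⟧ v = ⟦ s ⟧ v * ⟦ t ⟧ v
  ⟦ s ⇒ₜ t ⟧ v = ⟦ s ⟧ v ⇒ ⟦ t ⟧ v
  ⟦ oneₜ ⟧ v = one

  holds : Eqn Term → (ℕ → Carrier) → Set a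
  holds (s , t) v = ⟦ s ⟧ v ≡ ⟦ t ⟧ v

  Sat : QEqn Term → Set a
  Sat (ps ⟹ c) = (v : ℕ → Carrier) → All (λ e → holds e v) ps → holds c v

module _ {a : Level} (B : Struct* a) where
  open Struct* B
  ⟦_⟧* : Term* → (ℕ → Carrier) → Carrier
  ⟦ var x ⟧* v = v x
  ⟦ s ∧ₜ t ⟧* v = ⟦ s ⟧* v ∧ ⟦ t ⟧* v
  ⟦ s ∨ₜ t ⟧* v = ⟦ s ⟧* v ∨ ⟦ t ⟧* v
  ⟦ s *ₜ t ⟧* v = ⟦ s ⟧* v * ⟦ t ⟧* v
  ⟦ s ⇒ₜ t ⟧* v = ⟦ s ⟧* v ⇒ ⟦ t ⟧* v
  ⟦ ¬ₜ s ⟧* v = ¬ ⟦ s ⟧* v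
  ⟦ zeroₜ ⟧* v = zero
  ⟦ oneₜ ⟧* v = one

  holds* : Eqn Term* → (ℕ → Carrier) → Set a
  holds* (s , t) v = ⟦ s ⟧* v ≡ ⟦ t ⟧* v

  Sat* : QEqn Term* → Set a
  Sat* (ps ⟹ c) = (v : ℕ → Carrier) → All (λ e → holds* e v) ps → holds* c v

_⊨_ : ∀ {a ℓ} → (CIRL a → Set ℓ) → QEqn Term → Set (suc a ⊔ ℓ)
K ⊨ q = ∀ A → K A → Sat A q

_⊨*_ : ∀ {a ℓ} → (Struct* a → Set ℓ) → QEqn Term* → Set (suc a ⊔ ℓ)
K ⊨* q = ∀ B → K B → Sat* B q

-- a quasivariety of CIRLs: the class of all CIRLs satisfying some set Σ of
-- quasi-equations (CIRLs form a variety)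
IsQuasivariety : ∀ {a ℓ} → (CIRL a → Set ℓ) → Set (suc a ⊔ suc ℓ)
IsQuasivariety {a} {ℓ} Q =
  Σ (QEqn Term → Set ℓ) λ Th → ∀ A → Q A ⇔ (∀ q → Th q → Sat A q)

-- the quasivariety generated by a class K of Struct*-algebras:
-- Mod(quasi-equational theory of K)  ( = ISPP_U(K) )
QV : ∀ {a ℓ} → (Struct* a → Set ℓ) → Struct* a → Set (suc a ⊔ ℓ)
QV K B = ∀ r → K ⊨* r → Sat* B r

Doubles : ∀ {a ℓ} → (CIRL a → Set ℓ) → Struct* a → Set (suc a ⊔ ℓ)
Doubles {a} Q B = Σ (CIRL a) λ A → Q A × (double A ≡ B)

-- The heart of the argument concerns a single CIRL A and its double A*.
-- Call an element of A* positive if it lies in the copy of A.  For such d,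
-- d ∨ ¬d = d, while for d = ¬c we get d ∨ ¬d = c ≠ d; so the extra
-- premisses ¬x ⊑ x of q* say exactly that a valuation is positive on the
-- variables of q.  Since A is a subalgebra of A* for ⟨∧,∨,*,⇒,1⟩, a term of
-- q evaluated in A* under such a valuation w is the image of its value in A
-- under the restricted valuation.  Hence A ⊨ q iff A* ⊨ q*
-- (`double-transfer`).  Quantifying over A ∈ Q gives Q ⊨ q iff
-- {A* : A ∈ Q} ⊨ q*, and a class and the quasivariety it generates satisfy
-- the same quasi-equations (`QV-⊨*`).  The theorem does not use that Q is
-- a quasivariety: it holds for every class Q of CIRLs.

module Submission where

open import Defs
open import Level using (Level)
open import Function.Bundles using (_⇔_; mk⇔; Equivalence)
open Equivalence using (to; from)
open import Function.Properties.Equivalence using () renaming (trans to ⇔-trans; sym to ⇔-sym)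
open import Data.Nat using (ℕ)
open import Data.Sum using (_⊎_; inj₁; inj₂)
open import Data.Sum.Properties using (inj₁-injective)
open import Data.Product using (_,_; proj₁; proj₂)
open import Data.List using (List; []; _∷_; _++_; map; concatMap)
open import Data.List.Relation.Unary.All using (All; []; _∷_)
open import Data.List.Relation.Unary.All.Properties using (++⁺; ++⁻)
open import Relation.Binary.PropositionalEquality using (_≡_; refl; cong; cong₂; sym; trans)

module DoubleTransfer {a : Level} (A : CIRL a) where
  open CIRL A
  private
    A* = double A
    D = Carrier ⊎ Carrier

  underlying : D → Carrier
  underlying (inj₁ c) = c
  underlying (inj₂ c) = c

  Positive : D → Set a
  Positive d = d ≡ inj₁ (underlying d)

  negBelow-positive : ∀ (w : ℕ → D) x → holds* A* (negBelow x) w ⇔ Positive (w x)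
  negBelow-positive w x = mk⇔ (absorbs⇒positive (w x)) (positive⇒absorbs (w x))
    where
    absorbs⇒positive : ∀ d → djoin A d (dneg A d) ≡ d → Positive d
    absorbs⇒positive (inj₁ _) _ = refl
    absorbs⇒positive (inj₂ _) ()
    positive⇒absorbs : ∀ d → Positive d → djoin A d (dneg A d) ≡ d
    positive⇒absorbs (inj₁ _) _ = refl

  Agree : (ℕ → D) → (ℕ → Carrier) → List ℕ → Set a
  Agree w v = All (λ x → w x ≡ inj₁ (v x))

  -- A is a ⟨∧,∨,*,⇒,1⟩-subalgebra of A*: embedded terms are evaluated in A.
  embed-eval : ∀ w v t → Agree w v (vars t) → ⟦ A* ⟧* (embed t) w ≡ inj₁ (⟦ A ⟧ t v)
  embed-eval w v (var x) (wx ∷ []) = wx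
  embed-eval w v (s ∧ₜ t) ag = let agˢ , agᵗ = ++⁻ (vars s) ag in
    cong₂ (dmeet A) (embed-eval w v s agˢ) (embed-eval w v t agᵗ)
  embed-eval w v (s ∨ₜ t) ag = let agˢ , agᵗ = ++⁻ (vars s) ag in
    cong₂ (djoin A) (embed-eval w v s agˢ) (embed-eval w v t agᵗ)
  embed-eval w v (s *ₜ t) ag = let agˢ , agᵗ = ++⁻ (vars s) ag in
    cong₂ (dmul A) (embed-eval w v s agˢ) (embed-eval w v t agᵗ)
  embed-eval w v (s ⇒ₜ t) ag = let agˢ , agᵗ = ++⁻ (vars s) ag in
    cong₂ (dimp A) (embed-eval w v s agˢ) (embed-eval w v t agᵗ)
  embed-eval w v oneₜ [] = refl

  embedEqn-holds : ∀ w v e → Agree w v (eqnVars e) → holds* A* (embedEqn e) w ⇔ holds A e v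
  embedEqn-holds w v (s , t) ag =
    let ⟦s⟧ = embed-eval w v s (proj₁ (++⁻ (vars s) ag))
        ⟦t⟧ = embed-eval w v t (proj₂ (++⁻ (vars s) ag))
    in mk⇔ (λ h → inj₁-injective (trans (sym ⟦s⟧) (trans h ⟦t⟧)))
           (λ h → trans ⟦s⟧ (trans (cong inj₁ h) (sym ⟦t⟧)))

  embedEqns-hold : ∀ w v ps → Agree w v (concatMap eqnVars ps) →
                   All (λ e → holds* A* e w) (map embedEqn ps) ⇔ All (λ e → holds A e v) ps
  embedEqns-hold w v [] _ = mk⇔ (λ _ → []) (λ _ → [])
  embedEqns-hold w v (e ∷ ps) ag = mk⇔
    (λ { (h ∷ hs) → to head h ∷ to tail hs })
    (λ { (h ∷ hs) → from head h ∷ from tail hs })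
    where
    head = embedEqn-holds w v e (proj₁ (++⁻ (eqnVars e) ag))
    tail = embedEqns-hold w v ps (proj₂ (++⁻ (eqnVars e) ag))

  positive-agree : ∀ w xs → All (λ e → holds* A* e w) (map negBelow xs) →
                   Agree w (λ x → underlying (w x)) xs
  positive-agree w [] [] = []
  positive-agree w (x ∷ xs) (h ∷ hs) = to (negBelow-positive w x) h ∷ positive-agree w xs hs

  inj₁-negBelow : ∀ (v : ℕ → Carrier) xs →
                  All (λ e → holds* A* e (λ x → inj₁ (v x))) (map negBelow xs)
  inj₁-negBelow v [] = []
  inj₁-negBelow v (x ∷ xs) =
    from (negBelow-positive (λ y → inj₁ (v y)) x) refl ∷ inj₁-negBelow v xs

  inj₁-agree : ∀ (v : ℕ → Carrier) xs → Agree (λ x → inj₁ (v x)) v xs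
  inj₁-agree v [] = []
  inj₁-agree v (x ∷ xs) = refl ∷ inj₁-agree v xs

  double-transfer : ∀ q → Sat A q ⇔ Sat* A* (q *)
  double-transfer (ps ⟹ c) = mk⇔ forward backward
    where
    -- Under ¬x ⊑ x, w is positive on x⃗, so q* under w is q under its underlying valuation.
    forward : Sat A (ps ⟹ c) → Sat* A* ((ps ⟹ c) *)
    forward sat w h =
      let premisses , negBelows = ++⁻ (map embedEqn ps) h
          agreeᵖ , agreeᶜ = ++⁻ (concatMap eqnVars ps) (positive-agree w _ negBelows)
          v = λ x → underlying (w x)
      in from (embedEqn-holds w v c agreeᶜ) (sat v (to (embedEqns-hold w v ps agreeᵖ) premisses))

    backward : Sat* A* ((ps ⟹ c) *) → Sat A (ps ⟹ c)
    backward sat v h =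
      let w = λ x → inj₁ (v x)
          premisses = from (embedEqns-hold w v ps (inj₁-agree v _)) h
      in to (embedEqn-holds w v c (inj₁-agree v _)) (sat w (++⁺ premisses (inj₁-negBelow v _)))

open DoubleTransfer using (double-transfer)

QV-⊨* : ∀ {a ℓ} (K : Struct* a → Set ℓ) r → (QV K ⊨* r) ⇔ (K ⊨* r)
QV-⊨* K r = mk⇔ (λ sat B KB → sat B (λ r′ sat′ → sat′ B KB)) (λ sat B QVB → QVB r sat)

Doubles-⊨* : ∀ {a ℓ} (Q : CIRL a → Set ℓ) q → (Q ⊨ q) ⇔ (Doubles Q ⊨* (q *))
Doubles-⊨* Q q = mk⇔
  (λ sat → λ { _ (A , QA , refl) → to (double-transfer A q) (sat A QA) })
  (λ sat A QA → from (double-transfer A q) (sat (double A) (A , QA , refl)))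

proposition7p2 : ∀ {a ℓ : Level} (Q : CIRL a → Set ℓ) → IsQuasivariety Q →
    (q : QEqn Term) → (Q ⊨ q) ⇔ (QV (Doubles Q) ⊨* (q *))
proposition7p2 Q _ q = ⇔-trans (Doubles-⊨* Q q) (⇔-sym (QV-⊨* (Doubles Q) (q *)))
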